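{- Let $d\ge 2$ be an integer and let $f:\mathbb{F}_2^d\to\mathbb{F}_2$ be a linear bipermutive local rule $f(x_1,\ldots,x_d)=a_1x_1\oplus\cdots\oplus a_dx_d$ (so $a_1=a_d=1$), with associated polynomial $p_f(X) = a_1 + a_2X + \cdots + a_dX^{d-1}\in\mathbb{F}_2[X]$. Let $F:\mathbb{F}_2^{2(d-1)}\to\mathbb{F}_2^{d-1}$ be the no-boundary cellular automaton with local rule $f$. Then $F$ is self-orthogonal if and only if $\gcd(p_f(X), X^{d-1}+1) = 1$.
   Context: For a local rule $f:\mathbb{F}_2^d\to\mathbb{F}_2$, the no-boundary cellular automaton (NBCA) $F:\mathbb{F}_2^{2(d-1)}\to\mathbb{F}_2^{d-1}$ is defined by $F(x_1,\ldots,x_{2(d-1)}) = (f(x_1,\ldots,x_d), f(x_2,\ldots,x_{d+1}),\ldots, f(x_{d-1},\ldots,x_{2(d-1)}))$. The rule $f$ is bipermutive if it is a permutation in the first variable when the others are fixed, and in the last variable when the others are fixed. Let $N = 2^{d-1}$, fix a bijection $\phi:\mathbb{F}_2^{d-1}\to\{1,\ldots,N\}$ with inverse $\psi$. The Cayley table of $F$ is the $N\times N$ matrix $C_F$ with $C_F(i,j) = \phi(F(\psi(i)\|\psi(j)))$ ($\|$ is concatenation); for bipermutive $f$ it is a Latin square. Two Latin squares $L_1,L_2$ of order $N$ are orthogonal if the pairs $(L_1(i,j),L_2(i,j))$ are pairwise distinct over all $(i,j)$. $F$ is self-orthogonal if $C_F$ is orthogonal to its transpose $C_F^\top$. -}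

module Defs where

open import Data.Bool using (Bool; true; false; _xor_; _∧_)
open import Data.Nat using (ℕ; zero; suc; _+_; _^_)
open import Data.Nat.Properties using (+-comm; +-suc)
open import Data.Fin using (Fin)
open import Data.Vec using (Vec; []; _∷_; _++_; take; cast; _∷ʳ_; map; foldr; zipWith; toList; [_])
open import Data.List using (List; replicate) renaming ([] to []ₗ; _∷_ to _∷ₗ_; _++_ to _++ₗ_)
open import Data.List.Relation.Unary.All using (All)
open import Data.Product using (Σ; _×_)
open import Function.Definitions using (Bijective)
open import Function.Bundles using (_↔_; Inverse)
open import Relation.Binary.PropositionalEquality using (_≡_; sym)

-- F₂ is modelled by Bool with addition _xor_ and multiplication _∧_.

Bipermutive : ∀ {k} → (Vec Bool (suc (suc k)) → Bool) → Set
Bipermutive {k} f =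
  ((r : Vec Bool (suc k)) → Bijective _≡_ _≡_ (λ b → f (b ∷ r))) ×
  ((r : Vec Bool (suc k)) → Bijective _≡_ _≡_ (λ b → f (r ∷ʳ b)))

linearForm : ∀ {d} → Vec Bool d → Vec Bool d → Bool
linearForm a x = foldr _ _xor_ false (zipWith _∧_ a x)

windows : ∀ {A : Set} m d → Vec A (m + d) → Vec (Vec A d) (suc m)
windows zero    d xs       = [ xs ]
windows (suc m) d (x ∷ xs) =
  take d (cast (+-comm (suc m) d) (x ∷ xs)) ∷ windows m d xs

-- local rule on d = k + 2 cells; the NBCA maps 2(d-1) = 2(k+1) cells
-- to d-1 = k+1 cells.
NBCA : ∀ {k} → (Vec Bool (suc (suc k)) → Bool) →
       Vec Bool (suc k + suc k) → Vec Bool (suc k)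
NBCA {k} f x = map f (windows k (suc (suc k)) (cast (sym (+-suc k (suc k))) x))

-- C_F(i,j) = φ(F(ψ(i) ‖ ψ(j))), with φ : F₂^{d-1} ↔ {1..N}, N = 2^{d-1}
-- (indices 0..N-1 here)
cayley : ∀ {k} → (Vec Bool (suc (suc k)) → Bool) →
         (φ : Vec Bool (suc k) ↔ Fin (2 ^ suc k)) →
         Fin (2 ^ suc k) → Fin (2 ^ suc k) → Fin (2 ^ suc k)
cayley f φ i j = Inverse.to φ (NBCA f (Inverse.from φ i ++ Inverse.from φ j))

transpose : ∀ {n} {A : Set} → (Fin n → Fin n → A) → Fin n → Fin n → A
transpose L i j = L j i

Orthogonal : ∀ {n} → (L₁ L₂ : Fin n → Fin n → Fin n) → Set
Orthogonal L₁ L₂ = ∀ i j i′ j′ → L₁ i j ≡ L₁ i′ j′ → L₂ i j ≡ L₂ i′ j′ →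
                   (i ≡ i′ × j ≡ j′)

SelfOrthogonal : ∀ {k} → (Vec Bool (suc (suc k)) → Bool) →
                 (φ : Vec Bool (suc k) ↔ Fin (2 ^ suc k)) → Set
SelfOrthogonal f φ = Orthogonal (cayley f φ) (transpose (cayley f φ))

-- Polynomials over F₂: coefficient lists, lowest degree first
-- (trailing zero coefficients allowed; equality is up to them)

Poly : Set
Poly = List Bool

_+ₚ_ : Poly → Poly → Poly
[]ₗ       +ₚ q         = q
(a ∷ₗ p)  +ₚ []ₗ       = a ∷ₗ p
(a ∷ₗ p)  +ₚ (b ∷ₗ q)  = (a xor b) ∷ₗ (p +ₚ q)

scaleₚ : Bool → Poly → Poly
scaleₚ a []ₗ      = []ₗ
scaleₚ a (b ∷ₗ q) = (a ∧ b) ∷ₗ scaleₚ a q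

_*ₚ_ : Poly → Poly → Poly
[]ₗ      *ₚ q = []ₗ
(a ∷ₗ p) *ₚ q = scaleₚ a q +ₚ (false ∷ₗ (p *ₚ q))

-- equality in F₂[X]: p - q = p + q is the zero polynomial
_≈ₚ_ : Poly → Poly → Set
p ≈ₚ q = All (_≡ false) (p +ₚ q)

_∣ₚ_ : Poly → Poly → Set
g ∣ₚ p = Σ Poly (λ h → (g *ₚ h) ≈ₚ p)

oneₚ : Poly
oneₚ = true ∷ₗ []ₗ

-- gcd(p, q) = 1 : every common divisor is a unit; the only unit of F₂[X] is 1
GcdIsOne : Poly → Poly → Set
GcdIsOne p q = ∀ g → g ∣ₚ p → g ∣ₚ q → g ≈ₚ oneₚ

assocPoly : ∀ {d} → Vec Bool d → Poly
assocPoly a = toList a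

-- X^n + 1  (n ≥ 1 written as suc m)
Xⁿ+1 : ℕ → Poly
Xⁿ+1 m = true ∷ₗ (replicate m false ++ₗ (true ∷ₗ []ₗ))

{-# OPTIONS --safe #-}
-- Over F₂ the automaton F is linear, so its Cayley table is orthogonal to its
-- transpose iff (x, y) ↦ (F(x‖y), F(y‖x)) is injective, iff F(z‖z) = 0 forces
-- z = 0: for the differences u, v of two colliding pairs,
-- F(u⊕v ‖ u⊕v) = F(u‖v) ⊕ F(v‖u) = 0. Cell i of F(z‖z) is p_f(σ), σ the shift,
-- applied at i to the n-periodic extension of z (n = d - 1), and the n-periodic
-- sequences are exactly those killed by σⁿ + 1. If gcd(p_f, Xⁿ + 1) = 1,
-- Euclid's algorithm yields a common divisor of both that still kills such a
-- sequence, hence is 1. Conversely, a common divisor of positive degree leaves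
-- a cofactor h of Xⁿ + 1 of degree < n, and h(σ) applied to the indicator of
-- nℕ is a nonzero periodic sequence killed by p_f(σ).

module Submission where

open import Defs
open import Algebra.Bundles using (CommutativeRing)
import Algebra.Properties.CommutativeSemigroup as CommutativeSemigroupProperties
import Algebra.Properties.Group as GroupProperties
open import Data.Bool using (Bool; true; false; _xor_; _∧_)
open import Data.Bool.Properties
  using (xor-∧-commutativeRing; xor-comm; xor-assoc; xor-same; xor-identityʳ;
         ∧-assoc; ∧-zeroʳ; ∧-identityʳ; ∧-distribˡ-xor; ∧-distribʳ-xor)
open import Data.Nat using (ℕ; zero; suc; pred; _+_; _^_; _∸_; _≤_; _<_; z≤n; s≤s; _%_; _≡ᵇ_; _≤?_; _<?_)
open import Data.Nat.Properties
  using (+-commutativeSemigroup; +-suc; +-comm; +-identityʳ; ≤-refl; ≤-antisym; <⇒≤; ≤-trans; ≤-pred; <-≤-trans;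
         m≤n+m; m≤n⇒m<n∨m≡n; m+[n∸m]≡n; ≮⇒≥; ≰⇒>; m<n⇒0<n∸m; +-monoˡ-<; +-mono-≤-<; +-cancelˡ-<; m≤n⇒∃[o]m+o≡n)
open import Data.Nat.DivMod using (%-distribˡ-+; m%n%n≡m%n; [m+n]%n≡m%n; m<n⇒m%n≡m; n%n≡0; m%n<n)
open import Data.List using ([]; _∷_; length) renaming (replicate to replicateₗ; _++_ to _++ₗ_)
open import Data.Vec using (Vec; []; _∷_; _++_; lookup; tabulate; replicate; zipWith; take; cast; map; toList)
open import Data.Vec.Properties
  using (lookup-map; lookup-zipWith; lookup-replicate; lookup∘tabulate; tabulate∘lookup; tabulate-cong; map-id;
         length-toList; zipWith-++; zipWith-comm; zipWith-assoc; zipWith-identityˡ; zipWith-identityʳ; zipWith-inverseʳ)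
open import Data.Fin using (Fin; zero; suc; toℕ; fromℕ<)
open import Data.Fin.Properties using (toℕ-fromℕ<; toℕ<n)
open import Data.List.Relation.Unary.All using (All; []; _∷_)
open import Data.Product using (Σ-syntax; _×_; _,_; proj₁)
import Data.Product as Product
open import Data.Sum using (_⊎_; inj₁; inj₂)
open import Data.Empty using (⊥-elim)
open import Function using (_∘_; const; case_of_; _⟨_⟩_; _⇔_; mk⇔; Equivalence; _↔_; Inverse; Injection)
open import Function.Properties.Equivalence using () renaming (trans to ⇔-trans)
open import Function.Properties.Inverse using (↔⇒↣; ↔-sym)
open import Relation.Nullary using (¬_; yes; no)
open import Relation.Binary.Bundles using (Setoid)
import Relation.Binary.Reasoning.Setoid as SetoidReasoning
open import Relation.Binary.PropositionalEquality

private
  module Xor = CommutativeSemigroupProperties (CommutativeRing.+-commutativeSemigroup xor-∧-commutativeRing)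
  module And = CommutativeSemigroupProperties (CommutativeRing.*-commutativeSemigroup xor-∧-commutativeRing)
  module XorGroup = GroupProperties (CommutativeRing.+-group xor-∧-commutativeRing)
  module Plus = CommutativeSemigroupProperties +-commutativeSemigroup

  variable
    a : Bool
    i j m N : ℕ
    p p′ q q′ r g h u v : Poly
    Y Y′ Z : ℕ → Bool

xor≡false⇒≡ : ∀ x y → x xor y ≡ false → x ≡ y
xor≡false⇒≡ = XorGroup.x∙y⁻¹≈ε⇒x≈y

coef : Poly → ℕ → Bool
coef []      _       = false
coef (a ∷ p) zero    = a
coef (a ∷ p) (suc i) = coef p i

infix 4 _≐_
record _≐_ (p q : Poly) : Set where
  constructor mk≐
  field coef-≡ : ∀ i → coef p i ≡ coef q i
open _≐_

≐-refl : p ≐ p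
≐-refl = mk≐ λ _ → refl

≐-sym : p ≐ q → q ≐ p
≐-sym e = mk≐ (sym ∘ coef-≡ e)

≐-trans : p ≐ q → q ≐ r → p ≐ r
≐-trans e e′ = mk≐ λ i → trans (coef-≡ e i) (coef-≡ e′ i)

≐-setoid : Setoid _ _
≐-setoid = record
  { Carrier = Poly ; _≈_ = _≐_
  ; isEquivalence = record { refl = ≐-refl ; sym = ≐-sym ; trans = ≐-trans } }

module ≐-Reasoning = SetoidReasoning ≐-setoid

coef-+ : ∀ p q i → coef (p +ₚ q) i ≡ coef p i xor coef q i
coef-+ []      q       i       = refl
coef-+ (a ∷ p) []      i       = sym (xor-identityʳ _)
coef-+ (a ∷ p) (b ∷ q) zero    = refl
coef-+ (a ∷ p) (b ∷ q) (suc i) = coef-+ p q i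

coef-scale : ∀ a q i → coef (scaleₚ a q) i ≡ a ∧ coef q i
coef-scale a []      i       = sym (∧-zeroʳ a)
coef-scale a (b ∷ q) zero    = refl
coef-scale a (b ∷ q) (suc i) = coef-scale a q i

All-false⇒coef : All (_≡ false) u → ∀ i → coef u i ≡ false
All-false⇒coef []         _       = refl
All-false⇒coef (px ∷ pxs) zero    = px
All-false⇒coef (px ∷ pxs) (suc i) = All-false⇒coef pxs i

coef⇒All-false : ∀ u → (∀ i → coef u i ≡ false) → All (_≡ false) u
coef⇒All-false []      _ = []
coef⇒All-false (a ∷ u) h = h zero ∷ coef⇒All-false u (h ∘ suc)

≈ₚ⇒≐ : ∀ p q → p ≈ₚ q → p ≐ q
≈ₚ⇒≐ p q e = mk≐ λ i →
  xor≡false⇒≡ _ _ (trans (sym (coef-+ p q i)) (All-false⇒coef e i))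

≐⇒≈ₚ : p ≐ q → p ≈ₚ q
≐⇒≈ₚ {p} {q} e = coef⇒All-false (p +ₚ q) λ i →
  trans (coef-+ p q i) (trans (cong (_xor coef q i) (coef-≡ e i)) (xor-same (coef q i)))

+ₚ-cong : p ≐ p′ → q ≐ q′ → p +ₚ q ≐ p′ +ₚ q′
+ₚ-cong {p} {p′} {q} {q′} e e′ = mk≐ λ i →
  trans (coef-+ p q i) (trans (cong₂ _xor_ (coef-≡ e i) (coef-≡ e′ i)) (sym (coef-+ p′ q′ i)))

+ₚ-congʳ : ∀ q → p ≐ p′ → p +ₚ q ≐ p′ +ₚ q
+ₚ-congʳ q e = +ₚ-cong e ≐-refl

+ₚ-identityʳ : ∀ p → p +ₚ [] ≐ p
+ₚ-identityʳ []      = ≐-refl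
+ₚ-identityʳ (a ∷ p) = ≐-refl

+ₚ-cancelʳ : ∀ p q → (p +ₚ q) +ₚ q ≐ p
+ₚ-cancelʳ p q = mk≐ λ i → begin
  coef ((p +ₚ q) +ₚ q) i            ≡⟨ trans (coef-+ (p +ₚ q) q i) (cong (_xor coef q i) (coef-+ p q i)) ⟩
  (coef p i xor coef q i) xor coef q i ≡⟨ xor-assoc (coef p i) _ _ ⟩
  coef p i xor (coef q i xor coef q i) ≡⟨ cong (coef p i xor_) (xor-same (coef q i)) ⟩
  coef p i xor false                 ≡⟨ xor-identityʳ (coef p i) ⟩
  coef p i                           ∎
  where open ≡-Reasoning

+ₚ-swapʳ : ∀ p q r → (p +ₚ q) +ₚ r ≐ (p +ₚ r) +ₚ q
+ₚ-swapʳ p q r = mk≐ λ i → begin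
  coef ((p +ₚ q) +ₚ r) i                ≡⟨ trans (coef-+ (p +ₚ q) r i) (cong (_xor coef r i) (coef-+ p q i)) ⟩
  (coef p i xor coef q i) xor coef r i ≡⟨ Xor.xy∙z≈xz∙y (coef p i) _ _ ⟩
  (coef p i xor coef r i) xor coef q i ≡⟨ sym (trans (coef-+ (p +ₚ r) q i) (cong (_xor coef q i) (coef-+ p r i))) ⟩
  coef ((p +ₚ r) +ₚ q) i                ∎
  where open ≡-Reasoning

-- p acts as p(σ) for the left shift σ: act p Z i = ⊕ⱼ pⱼ ∧ Z (j + i).
act : Poly → (ℕ → Bool) → ℕ → Bool
act []      Z i = false
act (a ∷ u) Z i = (a ∧ Z i) xor act u Z (suc i)

Annihilates : Poly → (ℕ → Bool) → Set
Annihilates u Z = act u Z ≗ const false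

act-cong : ∀ u i i′ → (∀ j → j < length u → Y (j + i) ≡ Y′ (j + i′)) → act u Y i ≡ act u Y′ i′
act-cong []      i i′ h = refl
act-cong {Y} {Y′} (a ∷ u) i i′ h = cong₂ _xor_ (cong (a ∧_) (h 0 (s≤s z≤n)))
  (act-cong u (suc i) (suc i′) λ j j<u →
    trans (cong Y (+-suc j i)) (trans (h (suc j) (s≤s j<u)) (cong Y′ (sym (+-suc j i′)))))

act-≗ : ∀ u → Y ≗ Y′ → act u Y ≗ act u Y′
act-≗ u Y≗Y′ i = act-cong u i i λ j _ → Y≗Y′ (j + i)

act-shift : ∀ u Y o i → act u Y (o + i) ≡ act u (λ j → Y (o + j)) i
act-shift u Y o i = act-cong u (o + i) i λ j _ →
  cong Y (Plus.x∙yz≈y∙xz j o i)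

act-const-false : ∀ u → Annihilates u (const false)
act-const-false []      i = refl
act-const-false (a ∷ u) i = cong₂ _xor_ (∧-zeroʳ a) (act-const-false u (suc i))

act-zero : ∀ u → Z ≗ const false → Annihilates u Z
act-zero u Z≗0 i = trans (act-≗ u Z≗0 i) (act-const-false u i)

act-+ : ∀ u v Z i → act (u +ₚ v) Z i ≡ act u Z i xor act v Z i
act-+ []      v       Z i = refl
act-+ (a ∷ u) []      Z i = sym (xor-identityʳ _)
act-+ (a ∷ u) (b ∷ v) Z i =
  trans (cong₂ _xor_ (∧-distribʳ-xor (Z i) a b) (act-+ u v Z (suc i)))
        (Xor.interchange (a ∧ Z i) (b ∧ Z i) (act u Z (suc i)) (act v Z (suc i)))

act-scale : ∀ a u Z i → act (scaleₚ a u) Z i ≡ a ∧ act u Z i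
act-scale a []      Z i = sym (∧-zeroʳ a)
act-scale a (b ∷ u) Z i =
  trans (cong₂ _xor_ (∧-assoc a b (Z i)) (act-scale a u Z (suc i))) (sym (∧-distribˡ-xor a _ _))

act-* : ∀ u v Z i → act (u *ₚ v) Z i ≡ act u (act v Z) i
act-* []      v Z i = refl
act-* (a ∷ u) v Z i =
  trans (act-+ (scaleₚ a v) (false ∷ (u *ₚ v)) Z i) (cong₂ _xor_ (act-scale a v Z i) (act-* u v Z (suc i)))

act-xor : ∀ u Y Y′ i → act u (λ j → Y j xor Y′ j) i ≡ act u Y i xor act u Y′ i
act-xor []      Y Y′ i = refl
act-xor (b ∷ u) Y Y′ i =
  trans (cong₂ _xor_ (∧-distribˡ-xor b (Y i) (Y′ i)) (act-xor u Y Y′ (suc i)))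
        (Xor.interchange (b ∧ Y i) (b ∧ Y′ i) (act u Y (suc i)) (act u Y′ (suc i)))

act-∧ : ∀ a u Y i → act u (λ j → a ∧ Y j) i ≡ a ∧ act u Y i
act-∧ a []      Y i = sym (∧-zeroʳ a)
act-∧ a (b ∷ u) Y i =
  trans (cong₂ _xor_ (And.x∙yz≈y∙xz b a (Y i)) (act-∧ a u Y (suc i))) (sym (∧-distribˡ-xor a _ _))

act-comm : ∀ u v Z i → act u (act v Z) i ≡ act v (act u Z) i
act-comm []      v Z i = sym (act-const-false v i)
act-comm (a ∷ u) v Z i = begin
  (a ∧ act v Z i) xor act u (act v Z) (suc i)
    ≡⟨ cong ((a ∧ act v Z i) xor_) (act-comm u v Z (suc i)) ⟩
  (a ∧ act v Z i) xor act v (act u Z) (suc i)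
    ≡⟨ cong₂ _xor_ (sym (act-∧ a v Z i)) (act-shift v (act u Z) 1 i) ⟩
  act v (λ j → a ∧ Z j) i xor act v (λ j → act u Z (suc j)) i
    ≡⟨ sym (act-xor v _ _ i) ⟩
  act v (act (a ∷ u) Z) i ∎
  where open ≡-Reasoning

X^ : ℕ → Poly
X^ m = replicateₗ m false ++ₗ (true ∷ [])

act-X^ : ∀ m Z i → act (X^ m) Z i ≡ Z (m + i)
act-X^ zero    Z i = xor-identityʳ (Z i)
act-X^ (suc m) Z i = trans (act-X^ m Z (suc i)) (cong Z (+-suc m i))

act-oneₚ : ∀ Z → act oneₚ Z ≗ Z
act-oneₚ = act-X^ 0

act-≐[] : ∀ u → u ≐ [] → Annihilates u Z
act-≐[] []      e i = refl
act-≐[] (a ∷ u) e i = cong₂ _xor_ (cong (_∧ _) (coef-≡ e 0)) (act-≐[] u (mk≐ (coef-≡ e ∘ suc)) (suc i))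

act-≐ : u ≐ v → ∀ Z → act u Z ≗ act v Z
act-≐ {u} {v} e Z i =
  xor≡false⇒≡ _ _ (trans (sym (act-+ u v Z i)) (act-≐[] (u +ₚ v) u+v≐[] i))
  where
  u+v≐[] : u +ₚ v ≐ []
  u+v≐[] = mk≐ λ j → trans (coef-+ u v j) (trans (cong (_xor coef v j) (coef-≡ e j)) (xor-same (coef v j)))

-- The action is faithful: the unit sequence (i ≡ᵇ_) reads off the i-th
-- coefficient. So polynomial identities can be checked on actions, where
-- products become composition.
act-unit : ∀ u i → act u (i ≡ᵇ_) 0 ≡ coef u i
act-unit []      i       = refl
act-unit (a ∷ u) zero    =
  trans (cong₂ _xor_ (∧-identityʳ a) (trans (act-shift u (0 ≡ᵇ_) 1 0) (act-const-false u 0))) (xor-identityʳ a)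
act-unit (a ∷ u) (suc i) = cong₂ _xor_ (∧-zeroʳ a) (trans (act-shift u (suc i ≡ᵇ_) 1 0) (act-unit u i))

act-injective : (∀ Z → act u Z 0 ≡ act v Z 0) → u ≐ v
act-injective {u} {v} h = mk≐ λ i → trans (sym (act-unit u i)) (trans (h (i ≡ᵇ_)) (act-unit v i))

*ₚ-congˡ : ∀ p → q ≐ q′ → p *ₚ q ≐ p *ₚ q′
*ₚ-congˡ {q} {q′} p e = act-injective λ Z → begin
  act (p *ₚ q) Z 0    ≡⟨ act-* p q Z 0 ⟩
  act p (act q Z) 0   ≡⟨ act-≗ p (act-≐ e Z) 0 ⟩
  act p (act q′ Z) 0  ≡⟨ sym (act-* p q′ Z 0) ⟩
  act (p *ₚ q′) Z 0   ∎
  where open ≡-Reasoning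

*ₚ-congʳ : ∀ q → p ≐ p′ → p *ₚ q ≐ p′ *ₚ q
*ₚ-congʳ {p} {p′} q e = act-injective λ Z →
  trans (act-* p q Z 0) (trans (act-≐ e (act q Z) 0) (sym (act-* p′ q Z 0)))

*ₚ-assoc : ∀ p q r → (p *ₚ q) *ₚ r ≐ p *ₚ (q *ₚ r)
*ₚ-assoc p q r = act-injective λ Z → begin
  act ((p *ₚ q) *ₚ r) Z 0     ≡⟨ act-* (p *ₚ q) r Z 0 ⟩
  act (p *ₚ q) (act r Z) 0    ≡⟨ act-* p q (act r Z) 0 ⟩
  act p (act q (act r Z)) 0   ≡⟨ act-≗ p (sym ∘ act-* q r Z) 0 ⟩
  act p (act (q *ₚ r) Z) 0    ≡⟨ sym (act-* p (q *ₚ r) Z 0) ⟩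
  act (p *ₚ (q *ₚ r)) Z 0     ∎
  where open ≡-Reasoning

*ₚ-distribˡ-+ₚ : ∀ p q r → p *ₚ (q +ₚ r) ≐ (p *ₚ q) +ₚ (p *ₚ r)
*ₚ-distribˡ-+ₚ p q r = act-injective λ Z → begin
  act (p *ₚ (q +ₚ r)) Z 0                       ≡⟨ act-* p (q +ₚ r) Z 0 ⟩
  act p (act (q +ₚ r) Z) 0                      ≡⟨ act-≗ p (act-+ q r Z) 0 ⟩
  act p (λ j → act q Z j xor act r Z j) 0       ≡⟨ act-xor p (act q Z) (act r Z) 0 ⟩
  act p (act q Z) 0 xor act p (act r Z) 0       ≡⟨ sym (cong₂ _xor_ (act-* p q Z 0) (act-* p r Z 0)) ⟩
  act (p *ₚ q) Z 0 xor act (p *ₚ r) Z 0         ≡⟨ sym (act-+ (p *ₚ q) (p *ₚ r) Z 0) ⟩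
  act ((p *ₚ q) +ₚ (p *ₚ r)) Z 0                ∎
  where open ≡-Reasoning

*ₚ-identityˡ : ∀ q → oneₚ *ₚ q ≐ q
*ₚ-identityˡ q = act-injective λ Z → trans (act-* oneₚ q Z 0) (act-oneₚ (act q Z) 0)

*ₚ-identityʳ : ∀ p → p *ₚ oneₚ ≐ p
*ₚ-identityʳ p = act-injective λ Z → trans (act-* p oneₚ Z 0) (act-≗ p (act-oneₚ Z) 0)

*ₚ-zeroʳ : ∀ p → p *ₚ [] ≐ []
*ₚ-zeroʳ p = act-injective λ Z → trans (act-* p [] Z 0) (act-const-false p 0)

record DegreeBelow (p : Poly) (N : ℕ) : Set where
  constructor degreeBelow
  field vanishes : ∀ i → N ≤ i → coef p i ≡ false
open DegreeBelow

record Degree (p : Poly) (N : ℕ) : Set where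
  constructor degree
  field
    leading : coef p N ≡ true
    below   : DegreeBelow p (suc N)
open Degree

DegreeBelow-mono : m ≤ N → DegreeBelow p m → DegreeBelow p N
DegreeBelow-mono m≤N b = degreeBelow λ i N≤i → vanishes b i (≤-trans m≤N N≤i)

DegreeBelow-length : ∀ p → DegreeBelow p (length p)
DegreeBelow-length []      = degreeBelow λ _ _ → refl
DegreeBelow-length (a ∷ p) = degreeBelow λ { (suc i) (s≤s p≤i) → vanishes (DegreeBelow-length p) i p≤i }

DegreeBelow-step : DegreeBelow p (suc N) → coef p N ≡ false → DegreeBelow p N
DegreeBelow-step {p} {N} b pN≡false = degreeBelow vanish
  where
  vanish : ∀ i → N ≤ i → coef p i ≡ false
  vanish i N≤i with m≤n⇒m<n∨m≡n N≤i
  ... | inj₁ N<i  = vanishes b i N<i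
  ... | inj₂ refl = pN≡false

DegreeBelow-scale : ∀ a → DegreeBelow q N → DegreeBelow (scaleₚ a q) N
DegreeBelow-scale {q} a b = degreeBelow λ i N≤i →
  trans (coef-scale a q i) (trans (cong (a ∧_) (vanishes b i N≤i)) (∧-zeroʳ a))

Degree-≐ : p ≐ q → Degree p N → Degree q N
Degree-≐ e (degree l b) =
  degree (trans (sym (coef-≡ e _)) l) (degreeBelow λ i N<i → trans (sym (coef-≡ e i)) (vanishes b i N<i))

Degree-∷ : Degree p N → Degree (a ∷ p) (suc N)
Degree-∷ (degree l b) = degree l (degreeBelow λ { (suc i) (s≤s N<i) → vanishes b i N<i })

Degree-tail : Degree (a ∷ p) (suc N) → Degree p N
Degree-tail (degree l b) = degree l (degreeBelow λ i N<i → vanishes b (suc i) (s≤s N<i))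

Degree-zero⇒≐oneₚ : Degree p 0 → p ≐ oneₚ
Degree-zero⇒≐oneₚ (degree l b) = mk≐ λ { zero → l ; (suc i) → vanishes b (suc i) (s≤s z≤n) }

≐[]⇒¬Degree : p ≐ [] → ¬ Degree p N
≐[]⇒¬Degree {N = N} e (degree l _) with trans (sym l) (coef-≡ e N)
... | ()

degree<bound : Degree p m → DegreeBelow p N → m < N
degree<bound {m = m} {N} d b with m <? N
... | yes m<N = m<N
... | no  m≮N with trans (sym (leading d)) (vanishes b m (≮⇒≥ m≮N))
...   | ()

degree-unique : Degree p m → Degree p N → m ≡ N
degree-unique dm dN = ≤-antisym (≤-pred (degree<bound dm (below dN))) (≤-pred (degree<bound dN (below dm)))

Degree-+ : DegreeBelow q N → Degree p N → Degree (q +ₚ p) N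
Degree-+ {q} {N} {p} bq (degree l b) =
  degree (trans (coef-+ q p N) (cong₂ _xor_ (vanishes bq N ≤-refl) l))
         (degreeBelow λ i N<i → trans (coef-+ q p i) (cong₂ _xor_ (vanishes bq i (<⇒≤ N<i)) (vanishes b i N<i)))

Degree-* : ∀ u {v m m′} → Degree u m → Degree v m′ → Degree (u *ₚ v) (m + m′)
Degree-* []      (degree () _) _
Degree-* (a ∷ u) {v} {zero} du dv =
  Degree-≐ (≐-sym (≐-trans (*ₚ-congʳ v (Degree-zero⇒≐oneₚ du)) (*ₚ-identityˡ v))) dv
Degree-* (a ∷ u) {v} {suc m} {m′} du dv =
  Degree-+ (DegreeBelow-scale a (DegreeBelow-mono (s≤s (m≤n+m m′ m)) (below dv)))
           (Degree-∷ (Degree-* u (Degree-tail du) dv))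

Degree-X^ : ∀ m → Degree (X^ m) m
Degree-X^ zero    = degree refl (degreeBelow λ { (suc i) _ → refl })
Degree-X^ (suc m) = Degree-∷ (Degree-X^ m)

zero-or-degree : ∀ p → p ≐ [] ⊎ Σ[ N ∈ ℕ ] Degree p N
zero-or-degree []      = inj₁ ≐-refl
zero-or-degree (a ∷ p) with zero-or-degree p
... | inj₂ (N , d) = inj₂ (suc N , Degree-∷ d)
... | inj₁ p≐[] with a
...   | true  = inj₂ (0 , degree refl (degreeBelow λ { (suc i) _ → coef-≡ p≐[] i }))
...   | false = inj₁ (mk≐ λ { zero → refl ; (suc i) → coef-≡ p≐[] i })

cancel-leading : Degree p N → Degree q N → DegreeBelow (p +ₚ q) N
cancel-leading {p} {N} {q} dp dq = degreeBelow vanish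
  where
  vanish : ∀ i → N ≤ i → coef (p +ₚ q) i ≡ false
  vanish i N≤i with m≤n⇒m<n∨m≡n N≤i
  ... | inj₁ N<i  = trans (coef-+ p q i) (cong₂ _xor_ (vanishes (below dp) i N<i) (vanishes (below dq) i N<i))
  ... | inj₂ refl = trans (coef-+ p q N) (cong₂ _xor_ (leading dp) (leading dq))

factor-degrees : Degree q N → g *ₚ h ≐ q →
                 Σ[ m ∈ ℕ ] Σ[ m′ ∈ ℕ ] Degree g m × Degree h m′ × m + m′ ≡ N
factor-degrees {q} {N} {g} {h} dq gh≐q with zero-or-degree g | zero-or-degree h
... | inj₁ g≐[] | _ = ⊥-elim (≐[]⇒¬Degree (≐-trans (≐-sym gh≐q) (*ₚ-congʳ h g≐[])) dq)
... | inj₂ _ | inj₁ h≐[] =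
  ⊥-elim (≐[]⇒¬Degree (≐-trans (≐-sym gh≐q) (≐-trans (*ₚ-congˡ g h≐[]) (*ₚ-zeroʳ g))) dq)
... | inj₂ (m , dg) | inj₂ (m′ , dh) = m , m′ , dg , dh , degree-unique (Degree-≐ gh≐q (Degree-* g dg dh)) dq

act-leading : ∀ u → Degree u m → (∀ j → j < m → Y (j + i) ≡ false) → Y (m + i) ≡ true → act u Y i ≡ true
act-leading []      (degree () _) _ _
act-leading {zero} {i = i} (a ∷ u) (degree l b) _ Yi≡true =
  cong₂ _xor_ (cong₂ _∧_ l Yi≡true) (act-≐[] u (mk≐ λ j → vanishes b (suc j) (s≤s z≤n)) (suc i))
act-leading {suc m} {Y} {i} (a ∷ u) d Y<m Ym≡true =
  cong₂ _xor_ (trans (cong (a ∧_) (Y<m 0 (s≤s z≤n))) (∧-zeroʳ a))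
    (act-leading u (Degree-tail d) (λ j j<m → trans (cong Y (+-suc j i)) (Y<m (suc j) (s≤s j<m)))
                 (trans (cong Y (+-suc m i)) Ym≡true))

division-step : ∀ p q s t r → p +ₚ (q *ₚ t) ≐ (q *ₚ s) +ₚ r → p ≐ (q *ₚ (s +ₚ t)) +ₚ r
division-step p q s t r e = begin
  p                                   ≈⟨ ≐-sym (+ₚ-cancelʳ p (q *ₚ t)) ⟩
  (p +ₚ (q *ₚ t)) +ₚ (q *ₚ t)         ≈⟨ +ₚ-congʳ (q *ₚ t) e ⟩
  ((q *ₚ s) +ₚ r) +ₚ (q *ₚ t)         ≈⟨ +ₚ-swapʳ (q *ₚ s) r (q *ₚ t) ⟩
  ((q *ₚ s) +ₚ (q *ₚ t)) +ₚ r         ≈⟨ +ₚ-congʳ r (≐-sym (*ₚ-distribˡ-+ₚ q s t)) ⟩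
  (q *ₚ (s +ₚ t)) +ₚ r                ∎
  where open ≐-Reasoning

eliminate-leading : Degree q N → Degree p m → N ≤ m → Σ[ t ∈ Poly ] DegreeBelow (p +ₚ (q *ₚ t)) m
eliminate-leading {q} {N} {m = m} dq dp N≤m =
  X^ (m ∸ N) , cancel-leading dp (subst (Degree _) (m+[n∸m]≡n N≤m) (Degree-* q dq (Degree-X^ (m ∸ N))))

record Division (p q : Poly) (N : ℕ) : Set where
  constructor division
  field
    quotient remainder : Poly
    split              : p ≐ (q *ₚ quotient) +ₚ remainder
    remainder-below    : DegreeBelow remainder N
open Division

divide : Degree q N → ∀ p → Division p q N
divide {q} {N} dq p = reduce (length p) p (DegreeBelow-length p)
  where
  done : ∀ p → DegreeBelow p N → Division p q N
  done p p<N = division [] p (≐-sym (+ₚ-congʳ p (*ₚ-zeroʳ q))) p<N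

  reduce : ∀ B p → DegreeBelow p B → Division p q N
  reduce zero    p p<0 = done p (DegreeBelow-mono z≤n p<0)
  reduce (suc B) p p<1+B with coef p B in pB
  ... | false = reduce B p (DegreeBelow-step p<1+B pB)
  ... | true with N ≤? B
  ...   | no  N≰B = done p (DegreeBelow-mono (≰⇒> N≰B) p<1+B)
  ...   | yes N≤B with eliminate-leading dq (degree pB p<1+B) N≤B
  ...     | t , p+qt<B with reduce B (p +ₚ (q *ₚ t)) p+qt<B
  ...       | division s r e r<N = division (s +ₚ t) r (division-step p q s t r e) r<N

remainder-annihilates : (d : Division p q N) → Annihilates p Z → Annihilates q Z → Annihilates (remainder d) Z
remainder-annihilates {p} {q} {Z = Z} (division s r e _) pZ qZ i = begin
  act r Z i                                 ≡⟨⟩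
  false xor act r Z i                       ≡⟨ cong (_xor act r Z i) (sym qsZ) ⟩
  act (q *ₚ s) Z i xor act r Z i            ≡⟨ sym (act-+ (q *ₚ s) r Z i) ⟩
  act ((q *ₚ s) +ₚ r) Z i                   ≡⟨ act-≐ (≐-sym e) Z i ⟩
  act p Z i                                 ≡⟨ pZ i ⟩
  false                                     ∎
  where
  open ≡-Reasoning
  qsZ : act (q *ₚ s) Z i ≡ false
  qsZ = trans (act-* q s Z i) (trans (act-comm q s Z i) (act-zero s qZ i))

∣ₚ-refl : ∀ q → q ∣ₚ q
∣ₚ-refl q = oneₚ , ≐⇒≈ₚ (*ₚ-identityʳ q)

∣ₚ-dividend : (d : Division p q N) → g ∣ₚ q → g ∣ₚ remainder d → g ∣ₚ p
∣ₚ-dividend {p} {q} {g = g} (division s r e _) (h₁ , gh₁≈q) (h₂ , gh₂≈r) = (h₁ *ₚ s) +ₚ h₂ , ≐⇒≈ₚ (begin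
  g *ₚ ((h₁ *ₚ s) +ₚ h₂)              ≈⟨ *ₚ-distribˡ-+ₚ g (h₁ *ₚ s) h₂ ⟩
  (g *ₚ (h₁ *ₚ s)) +ₚ (g *ₚ h₂)       ≈⟨ +ₚ-cong (≐-sym (*ₚ-assoc g h₁ s)) gh₂≐r ⟩
  ((g *ₚ h₁) *ₚ s) +ₚ r               ≈⟨ +ₚ-congʳ r (*ₚ-congʳ s gh₁≐q) ⟩
  (q *ₚ s) +ₚ r                       ≈⟨ ≐-sym e ⟩
  p                                   ∎)
  where
  open ≐-Reasoning
  gh₁≐q : g *ₚ h₁ ≐ q
  gh₁≐q = ≈ₚ⇒≐ (g *ₚ h₁) q gh₁≈q
  gh₂≐r : g *ₚ h₂ ≐ r
  gh₂≐r = ≈ₚ⇒≐ (g *ₚ h₂) r gh₂≈r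

common-annihilating-divisor : Degree q N → Annihilates p Z → Annihilates q Z →
                              Σ[ g ∈ Poly ] g ∣ₚ p × g ∣ₚ q × Annihilates g Z
common-annihilating-divisor = euclid _ ≤-refl
  where
  euclid : ∀ B {p q N} → N < B → Degree q N → Annihilates p Z → Annihilates q Z →
           Σ[ g ∈ Poly ] g ∣ₚ p × g ∣ₚ q × Annihilates g Z
  euclid (suc B) {p} {q} N<1+B dq pZ qZ with divide dq p
  ... | d@(division s r e r<N) with zero-or-degree r
  ...   | inj₁ r≐[] = q , (s , ≐⇒≈ₚ qs≐p) , ∣ₚ-refl q , qZ
    where
    qs≐p : q *ₚ s ≐ p
    qs≐p = ≐-sym (≐-trans e (≐-trans (+ₚ-cong ≐-refl r≐[]) (+ₚ-identityʳ (q *ₚ s))))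
  ...   | inj₂ (M , dr) with euclid B (<-≤-trans (degree<bound dr r<N) (≤-pred N<1+B)) dr qZ
                                 (remainder-annihilates d pZ qZ)
  ...     | g , g∣q , g∣r , gZ = g , ∣ₚ-dividend {g = g} d g∣q g∣r , g∣q , gZ

-- Reads beyond the end of the vector give false.
at : ∀ {m} → Vec Bool m → ℕ → Bool
at []       _       = false
at (x ∷ xs) zero    = x
at (x ∷ xs) (suc j) = at xs j

at-toℕ : ∀ {m} (xs : Vec Bool m) i → at xs (toℕ i) ≡ lookup xs i
at-toℕ (x ∷ xs) zero    = refl
at-toℕ (x ∷ xs) (suc i) = at-toℕ xs i

at-tabulate : ∀ {m} (Y : ℕ → Bool) → j < m → at (tabulate {n = m} (Y ∘ toℕ)) j ≡ Y j
at-tabulate {j} {m} Y j<m = begin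
  at ys j                        ≡⟨ cong (at ys) (sym (toℕ-fromℕ< j<m)) ⟩
  at ys (toℕ (fromℕ< j<m))       ≡⟨ at-toℕ ys (fromℕ< j<m) ⟩
  lookup ys (fromℕ< j<m)         ≡⟨ lookup∘tabulate (Y ∘ toℕ) (fromℕ< j<m) ⟩
  Y (toℕ (fromℕ< j<m))           ≡⟨ cong Y (toℕ-fromℕ< j<m) ⟩
  Y j                            ∎
  where
  open ≡-Reasoning
  ys : Vec Bool m
  ys = tabulate (Y ∘ toℕ)

at-replicate : ∀ m j → at (replicate m false) j ≡ false
at-replicate zero    j       = refl
at-replicate (suc m) zero    = refl
at-replicate (suc m) (suc j) = at-replicate m j

at-++ˡ : ∀ {m m′} (xs : Vec Bool m) (ys : Vec Bool m′) → j < m → at (xs ++ ys) j ≡ at xs j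
at-++ˡ {zero}  (x ∷ xs) ys _         = refl
at-++ˡ {suc j} (x ∷ xs) ys (s≤s j<m) = at-++ˡ xs ys j<m

at-++ʳ : ∀ {m m′} (xs : Vec Bool m) (ys : Vec Bool m′) j → at (xs ++ ys) (m + j) ≡ at ys j
at-++ʳ []       ys j = refl
at-++ʳ (x ∷ xs) ys j = at-++ʳ xs ys j

at-cast : ∀ {m m′} .(eq : m ≡ m′) (xs : Vec Bool m) j → at (cast eq xs) j ≡ at xs j
at-cast {m′ = zero}   eq []       j       = refl
at-cast {m′ = suc _}  eq (x ∷ xs) zero    = refl
at-cast {m′ = suc m′} eq (x ∷ xs) (suc j) = at-cast {m′ = m′} (cong pred eq) xs j

at-take : ∀ d {m j} (xs : Vec Bool (d + m)) → j < d → at (take d xs) j ≡ at xs j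
at-take (suc d) {j = zero}  (x ∷ xs) _         = refl
at-take (suc d) {j = suc j} (x ∷ xs) (s≤s j<d) = at-take d xs j<d

at-windows : ∀ m d (xs : Vec Bool (m + d)) l → j < d → at (lookup (windows m d xs) l) j ≡ at xs (toℕ l + j)
at-windows zero    d xs       zero    j<d = refl
at-windows (suc m) d (x ∷ xs) zero    j<d = trans (at-take d _ j<d) (at-cast {m′ = d + suc m} _ (x ∷ xs) _)
at-windows (suc m) d (x ∷ xs) (suc l) j<d = at-windows m d xs l j<d

lookup-ext : ∀ {m} {xs ys : Vec Bool m} → (∀ i → lookup xs i ≡ lookup ys i) → xs ≡ ys
lookup-ext {xs = xs} {ys} h = trans (sym (tabulate∘lookup xs)) (trans (tabulate-cong h) (tabulate∘lookup ys))

infixl 6 _⊕_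
_⊕_ : ∀ {m} → Vec Bool m → Vec Bool m → Vec Bool m
_⊕_ = zipWith _xor_

0ᵛ : ∀ {m} → Vec Bool m
0ᵛ = replicate _ false

at-⊕ : ∀ {m} (xs ys : Vec Bool m) j → at (xs ⊕ ys) j ≡ at xs j xor at ys j
at-⊕ []       []       j       = refl
at-⊕ (x ∷ xs) (y ∷ ys) zero    = refl
at-⊕ (x ∷ xs) (y ∷ ys) (suc j) = at-⊕ xs ys j

⊕-self : ∀ {m} (xs : Vec Bool m) → xs ⊕ xs ≡ 0ᵛ
⊕-self xs = trans (cong (xs ⊕_) (sym (map-id xs))) (zipWith-inverseʳ xor-same xs)

⊕≡0ᵛ⇒≡ : ∀ {m} {xs ys : Vec Bool m} → xs ⊕ ys ≡ 0ᵛ → xs ≡ ys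
⊕≡0ᵛ⇒≡ {xs = xs} {ys} e = begin
  xs               ≡⟨ sym (zipWith-identityʳ xor-identityʳ xs) ⟩
  xs ⊕ 0ᵛ          ≡⟨ cong (xs ⊕_) (sym (⊕-self ys)) ⟩
  xs ⊕ (ys ⊕ ys)   ≡⟨ sym (zipWith-assoc xor-assoc xs ys ys) ⟩
  (xs ⊕ ys) ⊕ ys   ≡⟨ cong (_⊕ ys) e ⟩
  0ᵛ ⊕ ys          ≡⟨ zipWith-identityˡ (λ _ → refl) ys ⟩
  ys               ∎
  where open ≡-Reasoning

≡⇒⊕≡0ᵛ : ∀ {m} {xs ys : Vec Bool m} → xs ≡ ys → xs ⊕ ys ≡ 0ᵛ
≡⇒⊕≡0ᵛ {xs = xs} refl = ⊕-self xs

module _ {m w} (B : Vec Bool m → Vec Bool m → Vec Bool w) where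

  Additive : Set
  Additive = ∀ x y x′ y′ → B (x ⊕ x′) (y ⊕ y′) ≡ B x y ⊕ B x′ y′

  SymmetricPairInjective : Set
  SymmetricPairInjective = ∀ x y x′ y′ → B x y ≡ B x′ y′ → B y x ≡ B y′ x′ → x ≡ x′ × y ≡ y′

  DiagonalKernelTrivial : Set
  DiagonalKernelTrivial = ∀ z → B z z ≡ 0ᵛ → z ≡ 0ᵛ

module _ {m w} {B : Vec Bool m → Vec Bool m → Vec Bool w} (additive : Additive B) where

  symmetricPairInjective⇒diagonalKernelTrivial : SymmetricPairInjective B → DiagonalKernelTrivial B
  symmetricPairInjective⇒diagonalKernelTrivial injective z Bzz≡0 =
    proj₁ (injective z 0ᵛ 0ᵛ z Bz0≡B0z (sym Bz0≡B0z))
    where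
    Bz0≡B0z : B z 0ᵛ ≡ B 0ᵛ z
    Bz0≡B0z = ⊕≡0ᵛ⇒≡ (begin
      B z 0ᵛ ⊕ B 0ᵛ z      ≡⟨ sym (additive z 0ᵛ 0ᵛ z) ⟩
      B (z ⊕ 0ᵛ) (0ᵛ ⊕ z)  ≡⟨ cong₂ B (zipWith-identityʳ xor-identityʳ z) (zipWith-identityˡ (λ _ → refl) z) ⟩
      B z z                ≡⟨ Bzz≡0 ⟩
      0ᵛ                   ∎)
      where open ≡-Reasoning

  diagonalKernelTrivial⇒symmetricPairInjective : DiagonalKernelTrivial B → SymmetricPairInjective B
  diagonalKernelTrivial⇒symmetricPairInjective trivial x y x′ y′ Bxy≡Bx′y′ Byx≡By′x′ =
    ⊕≡0ᵛ⇒≡ Δx≡0 , ⊕≡0ᵛ⇒≡ (trans (sym Δx≡Δy) Δx≡0)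
    where
    Δx Δy : Vec Bool m
    Δx = x ⊕ x′
    Δy = y ⊕ y′
    BΔxΔy≡0 : B Δx Δy ≡ 0ᵛ
    BΔxΔy≡0 = trans (additive x y x′ y′) (≡⇒⊕≡0ᵛ Bxy≡Bx′y′)
    BΔyΔx≡0 : B Δy Δx ≡ 0ᵛ
    BΔyΔx≡0 = trans (additive y x y′ x′) (≡⇒⊕≡0ᵛ Byx≡By′x′)
    Δx≡Δy : Δx ≡ Δy
    Δx≡Δy = ⊕≡0ᵛ⇒≡ (trivial (Δx ⊕ Δy) (begin
      B (Δx ⊕ Δy) (Δx ⊕ Δy)  ≡⟨ cong (B (Δx ⊕ Δy)) (zipWith-comm xor-comm Δx Δy) ⟩
      B (Δx ⊕ Δy) (Δy ⊕ Δx)  ≡⟨ additive Δx Δy Δy Δx ⟩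
      B Δx Δy ⊕ B Δy Δx      ≡⟨ cong₂ _⊕_ BΔxΔy≡0 BΔyΔx≡0 ⟩
      0ᵛ ⊕ 0ᵛ                ≡⟨ ⊕-self 0ᵛ ⟩
      0ᵛ                     ∎))
      where open ≡-Reasoning
    Δx≡0 : Δx ≡ 0ᵛ
    Δx≡0 = trivial Δx (subst (λ t → B Δx t ≡ 0ᵛ) (sym Δx≡Δy) BΔxΔy≡0)

  symmetricPairInjective⇔diagonalKernelTrivial : SymmetricPairInjective B ⇔ DiagonalKernelTrivial B
  symmetricPairInjective⇔diagonalKernelTrivial =
    mk⇔ symmetricPairInjective⇒diagonalKernelTrivial diagonalKernelTrivial⇒symmetricPairInjective

Linear : ∀ {d} → (Vec Bool d → Bool) → Vec Bool d → Set
Linear f a = ∀ x → f x ≡ linearForm a x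

NBCA₂ : ∀ {k} → (Vec Bool (suc (suc k)) → Bool) → Vec Bool (suc k) → Vec Bool (suc k) → Vec Bool (suc k)
NBCA₂ f x y = NBCA f (x ++ y)

linearForm-act : ∀ {d} (a x : Vec Bool d) → linearForm a x ≡ act (toList a) (at x) 0
linearForm-act []      []      = refl
linearForm-act (b ∷ a) (y ∷ x) =
  cong ((b ∧ y) xor_) (trans (linearForm-act a x) (sym (act-shift (toList a) (at (y ∷ x)) 1 0)))

NBCA-lookup : ∀ {k f} (a : Vec Bool (suc (suc k))) → Linear f a →
              ∀ w l → lookup (NBCA f w) l ≡ act (toList a) (at w) (toℕ l)
NBCA-lookup {k} {f} a f-linear w l = begin
  lookup (map f ws) l                   ≡⟨ lookup-map l f ws ⟩
  f (lookup ws l)                       ≡⟨ f-linear (lookup ws l) ⟩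
  linearForm a (lookup ws l)            ≡⟨ linearForm-act a (lookup ws l) ⟩
  act (toList a) (at (lookup ws l)) 0   ≡⟨ act-cong (toList a) 0 (toℕ l) window ⟩
  act (toList a) (at w) (toℕ l)         ∎
  where
  open ≡-Reasoning
  w′ : Vec Bool (k + suc (suc k))
  w′ = cast (sym (+-suc k (suc k))) w
  ws : Vec (Vec Bool (suc (suc k))) (suc k)
  ws = windows k (suc (suc k)) w′
  window : ∀ j → j < length (toList a) → at (lookup ws l) (j + 0) ≡ at w (j + toℕ l)
  window j j<d = begin
    at (lookup ws l) (j + 0)  ≡⟨ cong (at (lookup ws l)) (+-identityʳ j) ⟩
    at (lookup ws l) j        ≡⟨ at-windows k (suc (suc k)) w′ l (subst (j <_) (length-toList a) j<d) ⟩
    at w′ (toℕ l + j)         ≡⟨ at-cast (sym (+-suc k (suc k))) w (toℕ l + j) ⟩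
    at w (toℕ l + j)          ≡⟨ cong (at w) (+-comm (toℕ l) j) ⟩
    at w (j + toℕ l)          ∎

NBCA₂-additive : ∀ {k f} (a : Vec Bool (suc (suc k))) → Linear f a → Additive (NBCA₂ f)
NBCA₂-additive {f = f} a f-linear x y x′ y′ = lookup-ext λ l → begin
  lookup (NBCA f ((x ⊕ x′) ++ (y ⊕ y′))) l
    ≡⟨ cong (λ w → lookup (NBCA f w) l) (sym (zipWith-++ _xor_ x y x′ y′)) ⟩
  lookup (NBCA f ((x ++ y) ⊕ (x′ ++ y′))) l
    ≡⟨ NBCA-lookup a f-linear _ l ⟩
  act (toList a) (at ((x ++ y) ⊕ (x′ ++ y′))) (toℕ l)
    ≡⟨ act-≗ (toList a) (at-⊕ (x ++ y) (x′ ++ y′)) (toℕ l) ⟩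
  act (toList a) (λ j → at (x ++ y) j xor at (x′ ++ y′) j) (toℕ l)
    ≡⟨ act-xor (toList a) (at (x ++ y)) (at (x′ ++ y′)) (toℕ l) ⟩
  act (toList a) (at (x ++ y)) (toℕ l) xor act (toList a) (at (x′ ++ y′)) (toℕ l)
    ≡⟨ sym (cong₂ _xor_ (NBCA-lookup a f-linear (x ++ y) l) (NBCA-lookup a f-linear (x′ ++ y′) l)) ⟩
  lookup (NBCA₂ f x y) l xor lookup (NBCA₂ f x′ y′) l
    ≡⟨ sym (lookup-zipWith _xor_ l (NBCA₂ f x y) (NBCA₂ f x′ y′)) ⟩
  lookup (NBCA₂ f x y ⊕ NBCA₂ f x′ y′) l
    ∎
  where open ≡-Reasoning

selfOrthogonal⇔symmetricPairInjective :
  ∀ {k} (f : Vec Bool (suc (suc k)) → Bool) (φ : Vec Bool (suc k) ↔ Fin (2 ^ suc k)) →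
  SelfOrthogonal f φ ⇔ SymmetricPairInjective (NBCA₂ f)
selfOrthogonal⇔symmetricPairInjective f φ = mk⇔ ⇒ ⇐
  where
  open Inverse φ using (to; from; strictlyInverseʳ)

  to-injective : ∀ {x y} → to x ≡ to y → x ≡ y
  to-injective = Injection.injective (↔⇒↣ φ)

  from-injective : ∀ {i j} → from i ≡ from j → i ≡ j
  from-injective = Injection.injective (↔⇒↣ (↔-sym φ))

  cayley-to : ∀ x y → cayley f φ (to x) (to y) ≡ to (NBCA₂ f x y)
  cayley-to x y = cong₂ (λ x y → to (NBCA₂ f x y)) (strictlyInverseʳ x) (strictlyInverseʳ y)

  cayley-cong : ∀ {x y x′ y′} → NBCA₂ f x y ≡ NBCA₂ f x′ y′ →
                cayley f φ (to x) (to y) ≡ cayley f φ (to x′) (to y′)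
  cayley-cong e = trans (cayley-to _ _) (trans (cong to e) (sym (cayley-to _ _)))

  ⇒ : SelfOrthogonal f φ → SymmetricPairInjective (NBCA₂ f)
  ⇒ orthogonal x y x′ y′ e e′ = Product.map to-injective to-injective
    (orthogonal (to x) (to y) (to x′) (to y′) (cayley-cong e) (cayley-cong e′))

  ⇐ : SymmetricPairInjective (NBCA₂ f) → SelfOrthogonal f φ
  ⇐ injective i j i′ j′ e e′ = Product.map from-injective from-injective
    (injective (from i) (from j) (from i′) (from j′) (to-injective e) (to-injective e′))

module PeriodicSequences (k : ℕ) where

  n : ℕ
  n = suc k

  Periodic : (ℕ → Bool) → Set
  Periodic Z = ∀ i → Z i ≡ Z (i % n)

  PeriodicKernelTrivial : Poly → Set
  PeriodicKernelTrivial p = ∀ Z → Periodic Z → Annihilates p Z → Z ≗ const false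

  %-absorbʳ : ∀ j i → (j + i % n) % n ≡ (j + i) % n
  %-absorbʳ j i = begin
    (j + i % n) % n            ≡⟨ %-distribˡ-+ j (i % n) n ⟩
    (j % n + i % n % n) % n    ≡⟨ cong (λ x → (j % n + x) % n) (m%n%n≡m%n i n) ⟩
    (j % n + i % n) % n        ≡⟨ sym (%-distribˡ-+ j i n) ⟩
    (j + i) % n                ∎
    where open ≡-Reasoning

  act-periodic : ∀ u → Periodic Z → Periodic (act u Z)
  act-periodic {Z} u Z-periodic i = act-cong u i (i % n) λ j _ → begin
    Z (j + i)             ≡⟨ Z-periodic (j + i) ⟩
    Z ((j + i) % n)       ≡⟨ cong Z (sym (%-absorbʳ j i)) ⟩
    Z ((j + i % n) % n)   ≡⟨ sym (Z-periodic (j + i % n)) ⟩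
    Z (j + i % n)         ∎
    where open ≡-Reasoning

  Degree-Xⁿ+1 : Degree (Xⁿ+1 k) n
  Degree-Xⁿ+1 = Degree-∷ (Degree-X^ k)

  Xⁿ+1-annihilates : Periodic Z → Annihilates (Xⁿ+1 k) Z
  Xⁿ+1-annihilates {Z} Z-periodic i = begin
    Z i xor act (X^ k) Z (suc i)   ≡⟨ cong (Z i xor_) (act-X^ k Z (suc i)) ⟩
    Z i xor Z (k + suc i)          ≡⟨ cong (λ x → Z i xor Z x) (trans (+-comm k (suc i)) (sym (+-suc i k))) ⟩
    Z i xor Z (i + n)              ≡⟨ cong (Z i xor_) Zi+n≡Zi ⟩
    Z i xor Z i                    ≡⟨ xor-same (Z i) ⟩
    false                          ∎
    where
    open ≡-Reasoning
    Zi+n≡Zi : Z (i + n) ≡ Z i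
    Zi+n≡Zi = trans (Z-periodic (i + n)) (trans (cong Z ([m+n]%n≡m%n i n)) (sym (Z-periodic i)))

  comb : ℕ → Bool
  comb i = i % n ≡ᵇ 0

  comb-periodic : Periodic comb
  comb-periodic i = cong (_≡ᵇ 0) (sym (m%n%n≡m%n i n))

  comb-between : 0 < i → i < n → comb i ≡ false
  comb-between {suc i} _ 1+i<n = cong (_≡ᵇ 0) (m<n⇒m%n≡m 1+i<n)

  act-comb-nonzero : Degree h m → m < n → act h comb (n ∸ m) ≡ true
  act-comb-nonzero {h} {m} dh m<n = act-leading h dh below-n at-n
    where
    m+[n∸m]≡n′ : m + (n ∸ m) ≡ n
    m+[n∸m]≡n′ = m+[n∸m]≡n (<⇒≤ m<n)
    at-n : comb (m + (n ∸ m)) ≡ true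
    at-n = trans (cong comb m+[n∸m]≡n′) (cong (_≡ᵇ 0) (n%n≡0 n))
    below-n : ∀ j → j < m → comb (j + (n ∸ m)) ≡ false
    below-n j j<m = comb-between (≤-trans (m<n⇒0<n∸m m<n) (m≤n+m (n ∸ m) j))
                                 (subst (j + (n ∸ m) <_) m+[n∸m]≡n′ (+-monoˡ-< (n ∸ m) j<m))

  cofactor-annihilates : ∀ g h₁ h₂ → g *ₚ h₁ ≐ p → g *ₚ h₂ ≐ Xⁿ+1 k → Annihilates p (act h₂ comb)
  cofactor-annihilates {p} g h₁ h₂ gh₁≐p gh₂≐q i = begin
    act p (act h₂ comb) i                ≡⟨ act-≐ (≐-sym gh₁≐p) (act h₂ comb) i ⟩
    act (g *ₚ h₁) (act h₂ comb) i        ≡⟨ act-* g h₁ (act h₂ comb) i ⟩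
    act g (act h₁ (act h₂ comb)) i       ≡⟨ act-comm g h₁ (act h₂ comb) i ⟩
    act h₁ (act g (act h₂ comb)) i       ≡⟨ act-≗ h₁ (λ j → sym (act-* g h₂ comb j)) i ⟩
    act h₁ (act (g *ₚ h₂) comb) i        ≡⟨ act-≗ h₁ (act-≐ gh₂≐q comb) i ⟩
    act h₁ (act (Xⁿ+1 k) comb) i         ≡⟨ act-zero h₁ (Xⁿ+1-annihilates comb-periodic) i ⟩
    false                                ∎
    where open ≡-Reasoning

  periodicKernelTrivial⇒gcdIsOne : PeriodicKernelTrivial p → GcdIsOne p (Xⁿ+1 k)
  periodicKernelTrivial⇒gcdIsOne {p} trivial g (h₁ , gh₁≈p) (h₂ , gh₂≈q)
    with factor-degrees Degree-Xⁿ+1 (≈ₚ⇒≐ (g *ₚ h₂) (Xⁿ+1 k) gh₂≈q)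
  ... | zero  , _  , dg , _   , _      = ≐⇒≈ₚ (Degree-zero⇒≐oneₚ dg)
  ... | suc m , m′ , _  , dh₂ , m+m′≡n =
    case trans (sym witness-nonzero) (trivial witness witness-periodic p-annihilates (n ∸ m′)) of λ ()
    where
    witness : ℕ → Bool
    witness = act h₂ comb
    witness-periodic : Periodic witness
    witness-periodic = act-periodic h₂ comb-periodic
    p-annihilates : Annihilates p witness
    p-annihilates = cofactor-annihilates g h₁ h₂ (≈ₚ⇒≐ (g *ₚ h₁) p gh₁≈p)
                                                 (≈ₚ⇒≐ (g *ₚ h₂) (Xⁿ+1 k) gh₂≈q)
    witness-nonzero : witness (n ∸ m′) ≡ true
    witness-nonzero = act-comb-nonzero dh₂ (subst (m′ <_) m+m′≡n (s≤s (m≤n+m m′ m)))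

  gcdIsOne⇒periodicKernelTrivial : GcdIsOne p (Xⁿ+1 k) → PeriodicKernelTrivial p
  gcdIsOne⇒periodicKernelTrivial gcd≡1 Z Z-periodic pZ i
    with common-annihilating-divisor Degree-Xⁿ+1 pZ (Xⁿ+1-annihilates Z-periodic)
  ... | g , g∣p , g∣q , gZ = begin
    Z i           ≡⟨ sym (act-oneₚ Z i) ⟩
    act oneₚ Z i  ≡⟨ act-≐ (≐-sym (≈ₚ⇒≐ g oneₚ (gcd≡1 g g∣p g∣q))) Z i ⟩
    act g Z i     ≡⟨ gZ i ⟩
    false         ∎
    where open ≡-Reasoning

  periodicKernelTrivial⇔gcdIsOne : PeriodicKernelTrivial p ⇔ GcdIsOne p (Xⁿ+1 k)
  periodicKernelTrivial⇔gcdIsOne = mk⇔ periodicKernelTrivial⇒gcdIsOne gcdIsOne⇒periodicKernelTrivial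

  cycle : Vec Bool n → ℕ → Bool
  cycle z i = at z (i % n)

  cycle-periodic : ∀ z → Periodic (cycle z)
  cycle-periodic z i = cong (at z) (sym (m%n%n≡m%n i n))

  cycle-tabulate : Periodic Z → cycle (tabulate (Z ∘ toℕ)) ≗ Z
  cycle-tabulate {Z} Z-periodic i = trans (at-tabulate Z (m%n<n i n)) (sym (Z-periodic i))

  cycle≗0⇒≡0ᵛ : ∀ z → cycle z ≗ const false → z ≡ 0ᵛ
  cycle≗0⇒≡0ᵛ z z≗0 = lookup-ext λ l → begin
    lookup z l               ≡⟨ sym (at-toℕ z l) ⟩
    at z (toℕ l)             ≡⟨ cong (at z) (sym (m<n⇒m%n≡m (toℕ<n l))) ⟩
    cycle z (toℕ l)          ≡⟨ z≗0 (toℕ l) ⟩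
    false                    ≡⟨ sym (lookup-replicate l false) ⟩
    lookup 0ᵛ l              ∎
    where open ≡-Reasoning

  at-++-self : ∀ z j → j < n + n → at (z ++ z) j ≡ cycle z j
  at-++-self z j j<2n with j <? n
  ... | yes j<n = trans (at-++ˡ z z j<n) (cong (at z) (sym (m<n⇒m%n≡m j<n)))
  ... | no  j≮n with m≤n⇒∃[o]m+o≡n (≮⇒≥ j≮n)
  ...   | o , refl = trans (at-++ʳ z z o) (cong (at z) (sym n+o%n≡o))
    where
    n+o%n≡o : (n + o) % n ≡ o
    n+o%n≡o = trans (cong (_% n) (+-comm n o))
                    (trans ([m+n]%n≡m%n o n) (m<n⇒m%n≡m (+-cancelˡ-< n o n j<2n)))

  module _ {f : Vec Bool (suc n) → Bool} (a : Vec Bool (suc n)) (f-linear : Linear f a) where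

    NBCA-diagonal : ∀ z l → lookup (NBCA₂ f z z) l ≡ act (toList a) (cycle z) (toℕ l)
    NBCA-diagonal z l = trans (NBCA-lookup a f-linear (z ++ z) l) (act-cong (toList a) (toℕ l) (toℕ l) λ j j<d →
      at-++-self z (j + toℕ l) (+-mono-≤-< (≤-pred (subst (j <_) (length-toList a) j<d)) (toℕ<n l)))

    NBCA-diagonal≡0ᵛ⇔ : ∀ z → NBCA₂ f z z ≡ 0ᵛ ⇔ Annihilates (toList a) (cycle z)
    NBCA-diagonal≡0ᵛ⇔ z = mk⇔ ⇒ ⇐
      where
      ⇒ : NBCA₂ f z z ≡ 0ᵛ → Annihilates (toList a) (cycle z)
      ⇒ diagonal≡0 i = begin
        act (toList a) (cycle z) i             ≡⟨ act-periodic (toList a) (cycle-periodic z) i ⟩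
        act (toList a) (cycle z) (i % n)       ≡⟨ cong (act (toList a) (cycle z)) (sym (toℕ-fromℕ< i%n<n)) ⟩
        act (toList a) (cycle z) (toℕ l)       ≡⟨ sym (NBCA-diagonal z l) ⟩
        lookup (NBCA₂ f z z) l                 ≡⟨ cong (λ v → lookup v l) diagonal≡0 ⟩
        lookup 0ᵛ l                            ≡⟨ lookup-replicate l false ⟩
        false                                  ∎
        where
        open ≡-Reasoning
        i%n<n : i % n < n
        i%n<n = m%n<n i n
        l : Fin n
        l = fromℕ< i%n<n

      ⇐ : Annihilates (toList a) (cycle z) → NBCA₂ f z z ≡ 0ᵛ
      ⇐ annihilates = lookup-ext λ l →
        trans (NBCA-diagonal z l) (trans (annihilates (toℕ l)) (sym (lookup-replicate l false)))

    diagonalKernelTrivial⇔periodicKernelTrivial : DiagonalKernelTrivial (NBCA₂ f) ⇔ PeriodicKernelTrivial (toList a)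
    diagonalKernelTrivial⇔periodicKernelTrivial = mk⇔ ⇒ ⇐
      where
      ⇒ : DiagonalKernelTrivial (NBCA₂ f) → PeriodicKernelTrivial (toList a)
      ⇒ trivial Z Z-periodic annihilates i = begin
        Z i                 ≡⟨ sym (cycle-tabulate Z-periodic i) ⟩
        cycle z i           ≡⟨ cong (λ v → cycle v i) z≡0 ⟩
        cycle 0ᵛ i          ≡⟨ at-replicate n (i % n) ⟩
        false               ∎
        where
        open ≡-Reasoning
        z : Vec Bool n
        z = tabulate (Z ∘ toℕ)
        z≡0 : z ≡ 0ᵛ
        z≡0 = trivial z (Equivalence.from (NBCA-diagonal≡0ᵛ⇔ z) λ i →
          trans (act-≗ (toList a) (cycle-tabulate Z-periodic) i) (annihilates i))

      ⇐ : PeriodicKernelTrivial (toList a) → DiagonalKernelTrivial (NBCA₂ f)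
      ⇐ trivial z diagonal≡0 =
        cycle≗0⇒≡0ᵛ z
          (trivial (cycle z) (cycle-periodic z) (Equivalence.to (NBCA-diagonal≡0ᵛ⇔ z) diagonal≡0))

corollary1 : (k : ℕ) → (f : Vec Bool (suc (suc k)) → Bool) → (a : Vec Bool (suc (suc k))) →
    ((x : Vec Bool (suc (suc k))) → f x ≡ linearForm a x) → Bipermutive f →
    (φ : Vec Bool (suc k) ↔ Fin (2 ^ suc k)) →
    SelfOrthogonal f φ ⇔ GcdIsOne (assocPoly a) (Xⁿ+1 k)
corollary1 k f a f-linear _ φ =
  selfOrthogonal⇔symmetricPairInjective f φ
  ⟨ ⇔-trans ⟩ symmetricPairInjective⇔diagonalKernelTrivial (NBCA₂-additive a f-linear)
  ⟨ ⇔-trans ⟩ diagonalKernelTrivial⇔periodicKernelTrivial a f-linear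
  ⟨ ⇔-trans ⟩ periodicKernelTrivial⇔gcdIsOne
  where open PeriodicSequences k
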